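{- Let $k\ge 3$ and let $\pi$ be a permutation containing an increasing or decreasing adjacency of length $k$, i.e. there is a position $i$ such that $\pi_{i+j}=\pi_i+j$ for all $0\le j\le k-1$, or $\pi_{i+j}=\pi_i-j$ for all $0\le j\le k-1$. Then $\mu(12\cdots(k-2),\pi)=0$, where $12\cdots(k-2)$ is the increasing permutation of length $k-2$.
   Context: Permutations are in one-line notation, ordered by pattern containment: $\sigma\le\pi$ if $\pi$ has a subsequence in the same relative order as $\sigma$. The Möbius function on this poset is $\mu(\sigma,\sigma)=1$, $\mu(\sigma,\lambda)=0$ if $\sigma\not\le\lambda$, and $\mu(\sigma,\lambda)=-\sum_{\sigma\le z<\lambda}\mu(\sigma,z)$ for $\sigma<\lambda$. -}

module Defs where

open import Data.Nat using (ℕ; zero; suc; _<?_)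
open import Data.List using (List; []; _∷_; _++_; map; length; filter; filterᵇ; upTo; concatMap; foldr)
open import Data.Bool.ListAction using (any)
open import Data.List.Relation.Binary.Permutation.Propositional using (_↭_)
open import Data.List.Relation.Binary.Equality.DecPropositional (Data.Nat._≟_) using (_≡?_)
open import Data.Bool using (Bool; true; false; if_then_else_; _∧_)
open import Relation.Nullary.Decidable using (⌊_⌋)
open import Relation.Binary.PropositionalEquality using (_≡_)
open import Data.Integer as ℤ using (ℤ)

-- Permutations in one-line notation are lists of naturals.
-- π is a permutation (of length n = length π) iff it is a rearrangement of 1,2,…,n.
[1‥_] : ℕ → List ℕ
[1‥ n ] = map suc (upTo n)

IsPerm : List ℕ → Set
IsPerm π = π ↭ [1‥ length π ]

insertions : ℕ → List ℕ → List (List ℕ)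
insertions x []       = (x ∷ []) ∷ []
insertions x (y ∷ ys) = (x ∷ y ∷ ys) ∷ map (y ∷_) (insertions x ys)

perms : ℕ → List (List ℕ)
perms zero    = [] ∷ []
perms (suc n) = concatMap (insertions (suc n)) (perms n)

subseqs : List ℕ → List (List ℕ)
subseqs []       = [] ∷ []
subseqs (x ∷ xs) = map (x ∷_) (subseqs xs) ++ subseqs xs

-- Standardisation: replace each entry by its rank among the entries
-- (for lists of distinct entries this gives the permutation in the same relative order).
std : List ℕ → List ℕ
std s = map (λ x → suc (length (filter (_<? x) s))) s

contains : List ℕ → List ℕ → Bool
contains σ π = any (λ s → ⌊ std s ≡? σ ⌋) (subseqs π)

_≼_ : List ℕ → List ℕ → Set
σ ≼ π = contains σ π ≡ true

sumℤ : List ℤ → ℤ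
sumℤ = foldr ℤ._+_ (ℤ.+ 0)

-- Möbius function of the permutation pattern poset, by the defining recursion
--   μ(σ,σ) = 1,  μ(σ,λ) = 0 if σ ≰ λ,  μ(σ,λ) = - Σ_{σ ≤ z < λ} μ(σ,z)  for σ < λ.
-- For a permutation λ, the z with z < λ are exactly the permutations of length < |λ|
-- contained in λ.  The fuel argument bounds the length of λ (initially |λ|), so
-- every recursive call is on some z with |z| < |λ|.
μ-aux : ℕ → List ℕ → List ℕ → ℤ
μ-aux zero    σ λ′ = if ⌊ λ′ ≡? σ ⌋ then ℤ.+ 1 else ℤ.+ 0
μ-aux (suc f) σ λ′ =
  if ⌊ λ′ ≡? σ ⌋ then ℤ.+ 1
  else if contains σ λ′
  then ℤ.- sumℤ (map (μ-aux f σ)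
                   (filterᵇ (λ z → contains σ z ∧ contains z λ′)
                            (concatMap perms (upTo (length λ′)))))
  else ℤ.+ 0

μ : List ℕ → List ℕ → ℤ
μ σ λ′ = μ-aux (length λ′) σ λ′

incRun : ℕ → ℕ → List ℕ
incRun a k = map (a Data.Nat.+_) (upTo k)

-- Let π contain a run R of length k, i.e. consecutive values in consecutive positions, in
-- increasing or decreasing order.  Deleting any one entry of R from π yields the same pattern A,
-- so every pattern contained in π is either contained in A or still contains a run of length k.
-- For |σ| ≤ k - 2, induction on |π| kills the μ(σ,z) of the latter kind, hence
--   μ(σ,π) = - Σ_{σ ≤ z < π} μ(σ,z) = - Σ_{σ ≤ z ≤ A} μ(σ,z) = 0,
-- where the last sum vanishes because σ < A.

module Submission where

open import Defs

open import Data.Bool using (Bool; true; false; if_then_else_; _∧_; not)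
open import Data.Bool.Properties using (T-≡; ∧-zeroʳ; ∧-identityʳ)
open import Data.Integer using (ℤ; +_; 0ℤ; -_) renaming (_+_ to _+ℤ_)
import Data.Integer.Properties as ℤ
open import Data.List using (List; []; _∷_; _++_; map; length; filter; filterᵇ; upTo; applyUpTo; concatMap; reverse)
open import Data.List.Extrema.Nat using (max; argmax-sel; ⊥≤max; xs≤max)
open import Data.List.Membership.Propositional using (_∈_; _∉_; find; lose)
open import Data.List.Membership.Propositional.Properties
  using (∈-map⁺; ∈-map⁻; ∈-++⁺ˡ; ∈-++⁺ʳ; ∈-++⁻; ∈-concatMap⁺; ∈-concatMap⁻; ∈-∃++; ∈-upTo⁻)
open import Data.List.Properties
  using ( ∷-injectiveˡ; ∷-injectiveʳ; ++-identityʳ; length-++; length-map; length-reverse; length-upTo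
        ; map-++; map-∘; map-id; map-cong-local; map-upTo; reverse-map; reverse-involutive; upTo-∷ʳ; concatMap-++
        ; filter-accept; filter-reject; filter-++; filter-all; filter-none )
open import Data.List.Relation.Binary.Disjoint.Propositional using (Disjoint)
open import Data.List.Relation.Binary.Equality.Propositional using (≋⇒≡)
open import Data.List.Relation.Binary.Permutation.Propositional using (↭⇒↭ₛ; ↭-sym)
open import Data.List.Relation.Binary.Permutation.Propositional.Properties using (↭-length; ↭-reverse; filter-↭; shift)
open import Data.List.Relation.Binary.Sublist.Propositional using (_⊆_; []; _∷_; _∷ʳ_; ⊆-refl; ⊆-trans)
open import Data.List.Relation.Binary.Sublist.Propositional.Properties
  using (length-mono-≤; to-≋; ++⁺; ++⁺ˡ; reverse⁺; map⁺; filter⁺; Any-resp-⊆; All-resp-⊆)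
open import Data.List.Relation.Unary.All as All using (All; []; _∷_)
import Data.List.Relation.Unary.All.Properties as All
open import Data.List.Relation.Unary.AllPairs using ([]; _∷_)
open import Data.List.Relation.Unary.Any using (here; there)
import Data.List.Relation.Unary.Any.Properties as Any
open import Data.List.Relation.Unary.Unique.Propositional using (Unique)
import Data.List.Relation.Unary.Unique.Propositional.Properties as Unique
open import Data.List.Relation.Unary.Unique.Propositional.Properties using (Unique[x∷xs]⇒x∉xs)
open import Data.Nat
  using (ℕ; zero; suc; pred; _+_; _∸_; _≤_; _<_; _<?_; _<ᵇ_; _≟_; z≤n; s≤s; s≤s⁻¹; z<s; s<s; ≢-nonZero)
open import Data.Nat.Properties
open import Data.Product using (∃-syntax; _×_; _,_; proj₁; proj₂)
open import Data.Sum using (_⊎_; inj₁; inj₂; [_,_]′)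
open import Function using (_∘_; id; Equivalence; _⇔_; mk⇔)
open import Relation.Binary.Definitions using (tri<; tri≈; tri>)
open import Relation.Binary.PropositionalEquality
open import Relation.Binary.PropositionalEquality.Properties using () renaming (setoid to ≡-setoid)
open import Relation.Nullary using (¬_; ¬?; yes; no; contradiction)
open import Relation.Nullary.Decidable using (⌊_⌋; toWitness; fromWitness)

open import Algebra.Properties.CommutativeSemigroup ℤ.+-commutativeSemigroup using (x∙yz≈y∙xz)
open import Data.List.Relation.Binary.Equality.DecPropositional _≟_ using (_≡?_)
open import Data.List.Relation.Binary.Permutation.Setoid.Properties (≡-setoid ℕ) using (Unique-resp-↭)

-- Sublists and pattern containment

⊆-++⁻ : ∀ xs {ys s : List ℕ} → s ⊆ xs ++ ys →
        ∃[ s₁ ] ∃[ s₂ ] (s ≡ s₁ ++ s₂ × s₁ ⊆ xs × s₂ ⊆ ys)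
⊆-++⁻ []       p         = [] , _ , refl , [] , p
⊆-++⁻ (x ∷ xs) (.x ∷ʳ p) with s₁ , s₂ , refl , p₁ , p₂ ← ⊆-++⁻ xs p =
  s₁ , s₂ , refl , x ∷ʳ p₁ , p₂
⊆-++⁻ (x ∷ xs) (refl ∷ p) with s₁ , s₂ , refl , p₁ , p₂ ← ⊆-++⁻ xs p =
  x ∷ s₁ , s₂ , refl , refl ∷ p₁ , p₂

⊆-map⁻ : ∀ (f : ℕ → ℕ) ys {s} → s ⊆ map f ys → ∃[ s′ ] (s′ ⊆ ys × s ≡ map f s′)
⊆-map⁻ f []       []        = [] , [] , refl
⊆-map⁻ f (y ∷ ys) (_ ∷ʳ p)  with s′ , q , e ← ⊆-map⁻ f ys p = s′ , y ∷ʳ q , e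
⊆-map⁻ f (y ∷ ys) (refl ∷ p) with s′ , q , refl ← ⊆-map⁻ f ys p = y ∷ s′ , refl ∷ q , refl

⊆-length-≡ : ∀ {xs ys : List ℕ} → xs ⊆ ys → length xs ≡ length ys → xs ≡ ys
⊆-length-≡ p e = ≋⇒≡ (to-≋ e p)

Unique-resp-⊇ : ∀ {xs ys : List ℕ} → xs ⊆ ys → Unique ys → Unique xs
Unique-resp-⊇ []         []       = []
Unique-resp-⊇ (_ ∷ʳ p)   (_ ∷ u)  = Unique-resp-⊇ p u
Unique-resp-⊇ (refl ∷ p) (x∉ ∷ u) = All-resp-⊆ p x∉ ∷ Unique-resp-⊇ p u

∈-subseqs⁺ : ∀ {s t} → s ⊆ t → s ∈ subseqs t
∈-subseqs⁺ []                      = here refl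
∈-subseqs⁺ {t = y ∷ ys} (_ ∷ʳ p) = ∈-++⁺ʳ (map (y ∷_) (subseqs ys)) (∈-subseqs⁺ p)
∈-subseqs⁺ (refl ∷ p)              = ∈-++⁺ˡ (∈-map⁺ _ (∈-subseqs⁺ p))

∈-subseqs⁻ : ∀ {s} t → s ∈ subseqs t → s ⊆ t
∈-subseqs⁻ []      (here refl) = []
∈-subseqs⁻ (y ∷ t) m with ∈-++⁻ (map (y ∷_) (subseqs t)) m
... | inj₂ m′ = y ∷ʳ ∈-subseqs⁻ t m′
... | inj₁ m′ with s′ , m″ , refl ← ∈-map⁻ (y ∷_) m′ = refl ∷ ∈-subseqs⁻ t m″

≼⇒⊆ : ∀ {σ π} → σ ≼ π → ∃[ s ] (s ⊆ π × std s ≡ σ)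
≼⇒⊆ {σ} {π} σ≼π with s , m , hit ← find (Any.any⁻ _ (subseqs π) (Equivalence.from T-≡ σ≼π)) =
  s , ∈-subseqs⁻ π m , toWitness hit

⊆⇒≼ : ∀ {s π} → s ⊆ π → std s ≼ π
⊆⇒≼ {s} p = Equivalence.to T-≡ (Any.any⁺ _ (lose (∈-subseqs⁺ p) (fromWitness {a? = std s ≡? std s} refl)))

-- Ranks and standardisation

below : ℕ → List ℕ → ℕ
below x l = length (filter (_<? x) l)

rank : List ℕ → ℕ → ℕ
rank l x = suc (below x l)

below-∷-< : ∀ {x y} l → y < x → below x (y ∷ l) ≡ suc (below x l)
below-∷-< l y<x = cong length (filter-accept (_<? _) y<x)

below-∷-≮ : ∀ {x y} l → ¬ y < x → below x (y ∷ l) ≡ below x l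
below-∷-≮ l y≮x = cong length (filter-reject (_<? _) y≮x)

below-++ : ∀ x l m → below x (l ++ m) ≡ below x l + below x m
below-++ x l m = trans (cong length (filter-++ (_<? x) l m)) (length-++ (filter (_<? x) l))

below-reverse : ∀ x l → below x (reverse l) ≡ below x l
below-reverse x l = ↭-length (filter-↭ (_<? x) (↭-reverse l))

below-all : ∀ {x} l → All (_< x) l → below x l ≡ length l
below-all l all< = cong length (filter-all (_<? _) all<)

below-none : ∀ {x} l → All (λ y → ¬ y < x) l → below x l ≡ 0
below-none l none< = cong length (filter-none (_<? _) none<)

below-map : ∀ (f : ℕ → ℕ) {x x′} l → (∀ {y} → y ∈ l → f y < x′ ⇔ y < x) →
            below x′ (map f l) ≡ below x l
below-map f []      same = refl
below-map f {x} {x′} (y ∷ l) same with y <? x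
... | yes y<x = begin
  below x′ (map f (y ∷ l))  ≡⟨ below-∷-< (map f l) (Equivalence.from (same (here refl)) y<x) ⟩
  suc (below x′ (map f l))  ≡⟨ cong suc (below-map f l (same ∘ there)) ⟩
  suc (below x l)           ≡⟨ below-∷-< l y<x ⟨
  below x (y ∷ l)           ∎
  where open ≡-Reasoning
... | no y≮x = begin
  below x′ (map f (y ∷ l))  ≡⟨ below-∷-≮ (map f l) (y≮x ∘ Equivalence.to (same (here refl))) ⟩
  below x′ (map f l)        ≡⟨ below-map f l (same ∘ there) ⟩
  below x l                 ≡⟨ below-∷-≮ l y≮x ⟨
  below x (y ∷ l)           ∎
  where open ≡-Reasoning

below-mono : ∀ {x y} l → x ≤ y → below x l ≤ below y l
below-mono l x≤y = length-mono-≤ (filter⁺ (_<? _) (_<? _) (λ { refl z<x → <-≤-trans z<x x≤y }) (⊆-refl {x = l}))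

below-strict : ∀ {x y} l → x ∈ l → x < y → below x l < below y l
below-strict {x} {y} (z ∷ l) (here refl) x<y = begin-strict
  below x (x ∷ l)  ≡⟨ below-∷-≮ l (<-irrefl refl) ⟩
  below x l        ≤⟨ below-mono l (<⇒≤ x<y) ⟩
  below y l        <⟨ n<1+n _ ⟩
  suc (below y l)  ≡⟨ below-∷-< l x<y ⟨
  below y (x ∷ l)  ∎
  where open ≤-Reasoning
below-strict {x} {y} (z ∷ l) (there x∈l) x<y with z <? x | z <? y
... | yes z<x | _       rewrite below-∷-< l z<x | below-∷-< l (<-trans z<x x<y) = s≤s (below-strict l x∈l x<y)
... | no z≮x  | yes z<y rewrite below-∷-≮ l z≮x | below-∷-< l z<y = m<n⇒m<1+n (below-strict l x∈l x<y)
... | no z≮x  | no z≮y  rewrite below-∷-≮ l z≮x | below-∷-≮ l z≮y = below-strict l x∈l x<y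

StrictlyIncreasingOn : (ℕ → ℕ) → List ℕ → Set
StrictlyIncreasingOn f l = ∀ {x y} → x ∈ l → y ∈ l → x < y → f x < f y

module _ {f : ℕ → ℕ} {l : List ℕ} (inc : StrictlyIncreasingOn f l) where

  increasing-reflects-< : ∀ {x y} → x ∈ l → y ∈ l → f x < f y → x < y
  increasing-reflects-< {x} {y} x∈ y∈ fx<fy with <-cmp x y
  ... | tri< x<y _ _ = x<y
  ... | tri≈ _ refl _ = contradiction fx<fy (<-irrefl refl)
  ... | tri> _ _ y<x = contradiction (inc y∈ x∈ y<x) (<-asym fx<fy)

  increasing-injective : ∀ {x y} → x ∈ l → y ∈ l → f x ≡ f y → x ≡ y
  increasing-injective {x} {y} x∈ y∈ fx≡fy with <-cmp x y
  ... | tri< x<y _ _ = contradiction fx≡fy (<⇒≢ (inc x∈ y∈ x<y))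
  ... | tri≈ _ x≡y _ = x≡y
  ... | tri> _ _ y<x = contradiction fx≡fy (≢-sym (<⇒≢ (inc y∈ x∈ y<x)))

  std-map : std (map f l) ≡ std l
  std-map = begin
    map (rank (map f l)) (map f l)  ≡⟨ map-∘ l ⟨
    map (rank (map f l) ∘ f) l      ≡⟨ map-cong-local (All.tabulate rank-preserved) ⟩
    map (rank l) l                  ∎
    where
    open ≡-Reasoning
    rank-preserved : ∀ {x} → x ∈ l → rank (map f l) (f x) ≡ rank l x
    rank-preserved x∈ = cong suc (below-map f l λ y∈ → mk⇔ (increasing-reflects-< y∈ x∈) (inc y∈ x∈))

increasing-⊆ : ∀ {f s t} → s ⊆ t → StrictlyIncreasingOn f t → StrictlyIncreasingOn f s
increasing-⊆ s⊆t inc x∈ y∈ = inc (Any-resp-⊆ s⊆t x∈) (Any-resp-⊆ s⊆t y∈)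

Unique-map-increasing : ∀ {f l} → StrictlyIncreasingOn f l → Unique l → Unique (map f l)
Unique-map-increasing inc []         = []
Unique-map-increasing inc (x∉ ∷ u) =
  All.map⁺ (All.tabulate λ y∈ fx≡fy → All.lookup x∉ y∈ (increasing-injective inc (here refl) (there y∈) fx≡fy))
  ∷ Unique-map-increasing (λ x∈ y∈ → inc (there x∈) (there y∈)) u

rank-increasing : ∀ l → StrictlyIncreasingOn (rank l) l
rank-increasing l x∈ _ x<y = s≤s (below-strict l x∈ x<y)

std-idempotent : ∀ l → std (std l) ≡ std l
std-idempotent l = std-map (rank-increasing l)

Unique-std : ∀ {l} → Unique l → Unique (std l)
Unique-std {l} = Unique-map-increasing (rank-increasing l)

⊆-std⁻ : ∀ {s} t → s ⊆ std t → ∃[ s′ ] (s′ ⊆ t × std s′ ≡ std s)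
⊆-std⁻ t s⊆ with s′ , s′⊆t , refl ← ⊆-map⁻ (rank t) t s⊆ =
  s′ , s′⊆t , sym (std-map (increasing-⊆ s′⊆t (rank-increasing t)))

⊆⇒std≼std : ∀ {s t} → s ⊆ t → std s ≼ std t
⊆⇒std≼std {s} {t} s⊆t =
  subst (_≼ std t) (std-map (increasing-⊆ s⊆t (rank-increasing t))) (⊆⇒≼ {map (rank t) s} (map⁺ (rank t) s⊆t))

≼-refl-std : ∀ l → std l ≼ std l
≼-refl-std l = ⊆⇒std≼std {l} ⊆-refl

≼-trans : ∀ {σ τ π} → σ ≼ τ → τ ≼ π → σ ≼ π
≼-trans {σ} {τ} {π} σ≼τ τ≼π
  with s , s⊆τ , refl ← ≼⇒⊆ {σ} {τ} σ≼τ
  with t , t⊆π , refl ← ≼⇒⊆ {τ} {π} τ≼π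
  with s′ , s′⊆t , std≡ ← ⊆-std⁻ t s⊆τ = subst (_≼ π) std≡ (⊆⇒≼ {s′} (⊆-trans s′⊆t t⊆π))

≼-std-length : ∀ {z} u → z ≼ std u → length z ≡ length u → z ≡ std u
≼-std-length {z} u z≼ |z|≡|u| with s , s⊆ , refl ← ≼⇒⊆ {z} z≼ =
  trans (cong std s≡) (std-idempotent u)
  where
  s≡ : s ≡ std u
  s≡ = ⊆-length-≡ s⊆ (trans (sym (length-map _ s)) (trans |z|≡|u| (sym (length-map _ u))))

-- Permutations of a given length

Unique-concatMap : ∀ {A B : Set} (f : A → List B) (g : B → A) {xs} → Unique xs →
                   (∀ {x} → x ∈ xs → Unique (f x)) →
                   (∀ {x w} → x ∈ xs → w ∈ f x → g w ≡ x) →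
                   Unique (concatMap f xs)
Unique-concatMap f g []         _       _    = []
Unique-concatMap f g {x ∷ xs} (x∉ ∷ u) uniq left =
  Unique.++⁺ (uniq (here refl)) (Unique-concatMap f g u (uniq ∘ there) (left ∘ there)) disjoint
  where
  disjoint : Disjoint (f x) (concatMap f xs)
  disjoint (w∈fx , w∈rest) with y , y∈xs , w∈fy ← find (∈-concatMap⁻ f w∈rest) =
    All.lookup x∉ y∈xs (trans (sym (left (here refl) w∈fx)) (left (there y∈xs) w∈fy))

∈-insertions⁻ : ∀ x l {w} → w ∈ insertions x l → ∃[ u ] ∃[ v ] (l ≡ u ++ v × w ≡ u ++ x ∷ v)
∈-insertions⁻ x []      (here refl) = [] , [] , refl , refl
∈-insertions⁻ x (y ∷ l) (here refl) = [] , y ∷ l , refl , refl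
∈-insertions⁻ x (y ∷ l) (there w∈) with w′ , w′∈ , refl ← ∈-map⁻ (y ∷_) w∈
  with u , v , refl , refl ← ∈-insertions⁻ x l w′∈ = y ∷ u , v , refl , refl

∈-insertions⁺ : ∀ x u v → u ++ x ∷ v ∈ insertions x (u ++ v)
∈-insertions⁺ x []      []      = here refl
∈-insertions⁺ x []      (y ∷ v) = here refl
∈-insertions⁺ x (y ∷ u) v       = there (∈-map⁺ (y ∷_) (∈-insertions⁺ x u v))

Unique-insertions : ∀ {x} l → x ∉ l → Unique (insertions x l)
Unique-insertions []      _   = [] ∷ []
Unique-insertions {x} (y ∷ l) x∉ =
  All.tabulate head-differs ∷ Unique.map⁺ ∷-injectiveʳ (Unique-insertions l (x∉ ∘ there))
  where
  head-differs : ∀ {w} → w ∈ map (y ∷_) (insertions x l) → x ∷ y ∷ l ≢ w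
  head-differs w∈ refl with _ , _ , e ← ∈-map⁻ (y ∷_) w∈ = x∉ (here (∷-injectiveˡ e))

erase : ℕ → List ℕ → List ℕ
erase x = filter (λ y → ¬? (y ≟ x))

erase-insertions : ∀ {x l w} → x ∉ l → w ∈ insertions x l → erase x w ≡ l
erase-insertions {x} {l} x∉ w∈ with u , v , refl , refl ← ∈-insertions⁻ x l w∈ = begin
  erase x (u ++ x ∷ v)          ≡⟨ filter-++ _ u (x ∷ v) ⟩
  erase x u ++ erase x (x ∷ v)  ≡⟨ cong (erase x u ++_) (filter-reject (λ y → ¬? (y ≟ x)) {x} {v} λ x≢x → x≢x refl) ⟩
  erase x u ++ erase x v        ≡⟨ cong₂ _++_ (filter-all _ (kept u (x∉ ∘ ∈-++⁺ˡ)))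
                                              (filter-all _ (kept v (x∉ ∘ ∈-++⁺ʳ u))) ⟩
  u ++ v                        ∎
  where
  open ≡-Reasoning
  kept : ∀ s → x ∉ s → All (_≢ x) s
  kept s x∉s = All.tabulate λ { y∈ refl → x∉s y∈ }

perms-length : ∀ n {z} → z ∈ perms n → length z ≡ n
perms-length zero    (here refl) = refl
perms-length (suc n) z∈ with p , p∈ , z∈ins ← find (∈-concatMap⁻ (insertions (suc n)) z∈)
  with u , v , refl , refl ← ∈-insertions⁻ (suc n) p z∈ins = begin
  length (u ++ suc n ∷ v)    ≡⟨ length-++ u ⟩
  length u + suc (length v)  ≡⟨ +-suc (length u) _ ⟩
  suc (length u + length v)  ≡⟨ cong suc (trans (sym (length-++ u)) (perms-length n p∈)) ⟩
  suc n                      ∎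
  where open ≡-Reasoning

perms-bounded : ∀ n {z} → z ∈ perms n → All (_≤ n) z
perms-bounded zero    (here refl) = []
perms-bounded (suc n) z∈ with p , p∈ , z∈ins ← find (∈-concatMap⁻ (insertions (suc n)) z∈)
  with u , v , refl , refl ← ∈-insertions⁻ (suc n) p z∈ins
  with bounds ← All.map m≤n⇒m≤1+n (perms-bounded n p∈) =
  All.++⁺ (All.++⁻ˡ u bounds) (≤-refl ∷ All.++⁻ʳ u bounds)

Unique-perms : ∀ n → Unique (perms n)
Unique-perms zero    = [] ∷ []
Unique-perms (suc n) =
  Unique-concatMap (insertions (suc n)) (erase (suc n)) (Unique-perms n)
    (λ p∈ → Unique-insertions _ (fresh p∈)) (λ p∈ → erase-insertions (fresh p∈))
  where
  fresh : ∀ {p} → p ∈ perms n → suc n ∉ p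
  fresh p∈ sn∈p = <-irrefl refl (All.lookup (perms-bounded n p∈) sn∈p)

below-insert-≮ : ∀ {y m} l r → ¬ m < y → below y (l ++ m ∷ r) ≡ below y (l ++ r)
below-insert-≮ {y} {m} l r m≮y = begin
  below y (l ++ m ∷ r)          ≡⟨ below-++ y l (m ∷ r) ⟩
  below y l + below y (m ∷ r)   ≡⟨ cong (_+_ (below y l)) (below-∷-≮ r m≮y) ⟩
  below y l + below y r         ≡⟨ below-++ y l r ⟨
  below y (l ++ r)              ∎
  where open ≡-Reasoning

std-insert-max : ∀ l m r → All (_< m) (l ++ r) →
                 std (l ++ m ∷ r) ≡ map (rank (l ++ r)) l ++ suc (length (l ++ r)) ∷ map (rank (l ++ r)) r
std-insert-max l m r all<m = begin
  map (rank t) (l ++ m ∷ r)                          ≡⟨ map-++ (rank t) l (m ∷ r) ⟩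
  map (rank t) l ++ rank t m ∷ map (rank t) r       ≡⟨ cong₂ _++_ (rank-unchanged l (All.++⁻ˡ l all<m))
                                                         (cong₂ _∷_ rank-max (rank-unchanged r (All.++⁻ʳ l all<m))) ⟩
  map (rank (l ++ r)) l ++ suc (length (l ++ r)) ∷ map (rank (l ++ r)) r  ∎
  where
  open ≡-Reasoning
  t = l ++ m ∷ r
  rank-max : rank t m ≡ suc (length (l ++ r))
  rank-max = cong suc (trans (below-insert-≮ l r (<-irrefl refl)) (below-all (l ++ r) all<m))
  rank-unchanged : ∀ s → All (_< m) s → map (rank t) s ≡ map (rank (l ++ r)) s
  rank-unchanged s all< = map-cong-local (All.map (λ y<m → cong suc (below-insert-≮ l r (<-asym y<m))) all<)

max∈ : ∀ x t → max x t ∈ x ∷ t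
max∈ x t = [ here , there ]′ (argmax-sel id x t)

std-∈-perms : ∀ n {t} → length t ≡ n → Unique t → std t ∈ perms n
std-∈-perms zero    {[]}    _ _ = here refl
std-∈-perms (suc n) {x ∷ t} |t|≡ uniq with l , r , split ← ∈-∃++ (max∈ x t) =
  subst (λ s → std s ∈ perms (suc n)) (sym split)
    (subst (_∈ perms (suc n)) (sym std≡)
      (∈-concatMap⁺ (insertions (suc n)) (lose IH (∈-insertions⁺ (suc n) (map ρ l) (map ρ r)))))
  where
  m = max x t
  ρ = rank (l ++ r)
  uniq′ : Unique (l ++ m ∷ r)
  uniq′ = subst Unique split uniq
  m∉ : m ∉ l ++ r
  m∉ = Unique[x∷xs]⇒x∉xs (Unique-resp-↭ (↭⇒↭ₛ (shift m l r)) uniq′)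
  drop-m : l ++ r ⊆ l ++ m ∷ r
  drop-m = ++⁺ ⊆-refl (m ∷ʳ ⊆-refl)
  all≤m : All (_≤ m) (l ++ r)
  all≤m = All-resp-⊆ drop-m (subst (All (_≤ m)) split (⊥≤max x t ∷ xs≤max x t))
  all<m : All (_< m) (l ++ r)
  all<m = All.tabulate λ y∈ → ≤∧≢⇒< (All.lookup all≤m y∈) λ { refl → m∉ y∈ }
  |l++r|≡ : length (l ++ r) ≡ n
  |l++r|≡ = suc-injective (trans (sym (↭-length (shift m l r))) (trans (cong length (sym split)) |t|≡))
  std≡ : std (l ++ m ∷ r) ≡ map ρ l ++ suc n ∷ map ρ r
  std≡ = trans (std-insert-max l m r all<m) (cong (λ k → map ρ l ++ suc k ∷ map ρ r) |l++r|≡)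
  IH : map ρ l ++ map ρ r ∈ perms n
  IH = subst (_∈ perms n) (map-++ ρ l r) (std-∈-perms n |l++r|≡ (Unique-resp-⊇ drop-m uniq′))

shorterPerms : ℕ → List (List ℕ)
shorterPerms n = concatMap perms (upTo n)

shorterPerms-suc : ∀ n → shorterPerms (suc n) ≡ shorterPerms n ++ perms n
shorterPerms-suc n = begin
  concatMap perms (upTo (suc n))      ≡⟨ cong (concatMap perms) (upTo-∷ʳ n) ⟨
  concatMap perms (upTo n ++ n ∷ [])  ≡⟨ concatMap-++ perms (upTo n) (n ∷ []) ⟩
  shorterPerms n ++ (perms n ++ [])   ≡⟨ cong (shorterPerms n ++_) (++-identityʳ (perms n)) ⟩
  shorterPerms n ++ perms n           ∎
  where open ≡-Reasoning

∈-shorterPerms⁻ : ∀ n {z} → z ∈ shorterPerms n → length z < n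
∈-shorterPerms⁻ n z∈ with k , k∈ , z∈perms ← find (∈-concatMap⁻ perms z∈) =
  subst (_< n) (sym (perms-length k z∈perms)) (∈-upTo⁻ k∈)

-- Sums over intervals and the Möbius function

sumWhere : (List ℕ → ℤ) → (List ℕ → Bool) → List (List ℕ) → ℤ
sumWhere h p L = sumℤ (map h (filterᵇ p L))

module _ (h : List ℕ → ℤ) where

  sumWhere-++ : ∀ p L M → sumWhere h p (L ++ M) ≡ sumWhere h p L +ℤ sumWhere h p M
  sumWhere-++ p []      M = sym (ℤ.+-identityˡ _)
  sumWhere-++ p (z ∷ L) M with p z
  ... | false = sumWhere-++ p L M
  ... | true  = trans (cong (h z +ℤ_) (sumWhere-++ p L M)) (sym (ℤ.+-assoc (h z) _ _))

  sumWhere-split : ∀ (p q : List ℕ → Bool) L →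
                   sumWhere h p L ≡ sumWhere h (λ z → p z ∧ q z) L +ℤ sumWhere h (λ z → p z ∧ not (q z)) L
  sumWhere-split p q []      = refl
  sumWhere-split p q (z ∷ L) with p z | q z
  ... | false | _     = sumWhere-split p q L
  ... | true  | true  = trans (cong (h z +ℤ_) (sumWhere-split p q L)) (sym (ℤ.+-assoc (h z) _ _))
  ... | true  | false = trans (cong (h z +ℤ_) (sumWhere-split p q L)) (x∙yz≈y∙xz (h z) (sumWhere h (λ z → p z ∧ q z) L) _)

  sumWhere-zero : ∀ p L → (∀ {z} → z ∈ L → p z ≡ true → h z ≡ 0ℤ) → sumWhere h p L ≡ 0ℤ
  sumWhere-zero p []      _ = refl
  sumWhere-zero p (z ∷ L) vanish with p z in pz
  ... | false = sumWhere-zero p L (vanish ∘ there)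
  ... | true  = cong₂ _+ℤ_ (vanish (here refl) pz) (sumWhere-zero p L (vanish ∘ there))

  sumWhere-cong : ∀ {p q} L → (∀ z → p z ≡ q z) → sumWhere h p L ≡ sumWhere h q L
  sumWhere-cong []      _   = refl
  sumWhere-cong {p} {q} (z ∷ L) p≗q with p z | q z | p≗q z
  ... | true  | true  | refl = cong (h z +ℤ_) (sumWhere-cong L p≗q)
  ... | false | false | refl = sumWhere-cong L p≗q

  sumWhere-single : ∀ p {a} L → Unique L → a ∈ L → (∀ {z} → z ∈ L → p z ≡ true → z ≡ a) →
                    sumWhere h p L ≡ (if p a then h a else 0ℤ)
  sumWhere-single p (z ∷ L) (z∉ ∷ u) (here refl) only-a with p z
  ... | true  = trans (cong (h z +ℤ_) (sumWhere-zero p L rest-vanishes)) (ℤ.+-identityʳ (h z))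
    where rest-vanishes : ∀ {w} → w ∈ L → p w ≡ true → h w ≡ 0ℤ
          rest-vanishes w∈ pw = contradiction (sym (only-a (there w∈) pw)) (All.lookup z∉ w∈)
  ... | false = sumWhere-zero p L λ w∈ pw → contradiction (sym (only-a (there w∈) pw)) (All.lookup z∉ w∈)
  sumWhere-single p (z ∷ L) (z∉ ∷ u) (there a∈) only-a with p z in pz
  ... | true  = contradiction (only-a (here refl) pz) (All.lookup z∉ a∈)
  ... | false = sumWhere-single p L u a∈ (only-a ∘ there)

sumWhere-cong-on : ∀ {h g} p L → (∀ {z} → z ∈ L → h z ≡ g z) → sumWhere h p L ≡ sumWhere g p L
sumWhere-cong-on p []      _   = refl
sumWhere-cong-on p (z ∷ L) h≗g with p z
... | false = sumWhere-cong-on p L (h≗g ∘ there)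
... | true  = cong₂ _+ℤ_ (h≗g (here refl)) (sumWhere-cong-on p L (h≗g ∘ there))

between : List ℕ → List ℕ → List ℕ → Bool
between σ τ z = contains σ z ∧ contains z τ

intervalSum : List ℕ → List ℕ → List (List ℕ) → ℤ
intervalSum σ τ = sumWhere (μ σ) (between σ τ)

μ-aux-fuel : ∀ f f′ σ z → length z ≤ f → length z ≤ f′ → μ-aux f σ z ≡ μ-aux f′ σ z
μ-aux-fuel zero    zero     σ z  _ _ = refl
μ-aux-fuel zero    (suc f′) σ [] _ _ with ⌊ [] ≡? σ ⌋ | contains σ []
... | true  | _     = refl
... | false | true  = refl
... | false | false = refl
μ-aux-fuel (suc f) zero     σ [] _ _ = sym (μ-aux-fuel zero (suc f) σ [] z≤n z≤n)
μ-aux-fuel (suc f) (suc f′) σ z  |z|≤f |z|≤f′ with ⌊ z ≡? σ ⌋ | contains σ z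
... | true  | _     = refl
... | false | false = refl
... | false | true  = cong -_ (sumWhere-cong-on (between σ z) (shorterPerms (length z)) λ z′∈ →
  let |z′|<|z| = ∈-shorterPerms⁻ (length z) z′∈ in
  μ-aux-fuel f f′ σ _ (≤-pred (≤-trans |z′|<|z| |z|≤f)) (≤-pred (≤-trans |z′|<|z| |z|≤f′)))

μ-aux-enough-fuel : ∀ {f} σ z → length z ≤ f → μ-aux f σ z ≡ μ σ z
μ-aux-enough-fuel σ z |z|≤f = μ-aux-fuel _ _ σ z |z|≤f ≤-refl

μ-unfold : ∀ σ τ → τ ≢ σ →
           μ σ τ ≡ (if contains σ τ then - intervalSum σ τ (shorterPerms (length τ)) else 0ℤ)
μ-unfold σ [] []≢σ with [] ≡? σ | contains σ []
... | yes []≡σ | _     = contradiction []≡σ []≢σ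
... | no _     | true  = refl
... | no _     | false = refl
μ-unfold σ τ@(_ ∷ _) τ≢σ with τ ≡? σ | contains σ τ
... | yes τ≡σ | _     = contradiction τ≡σ τ≢σ
... | no _    | false = refl
... | no _    | true  = cong -_ (sumWhere-cong-on (between σ τ) (shorterPerms (length τ)) λ z∈ →
                          μ-aux-enough-fuel σ _ (≤-pred (∈-shorterPerms⁻ (length τ) z∈)))

∧-true⁻ : ∀ {a b} → a ∧ b ≡ true → a ≡ true × b ≡ true
∧-true⁻ {true} b≡true = refl , b≡true

-- The top term μ(σ, std u) cancels the sum over the patterns strictly below std u.
intervalSum-closed : ∀ σ u → Unique u → std u ≢ σ →
                     intervalSum σ (std u) (shorterPerms (suc (length u))) ≡ 0ℤ
intervalSum-closed σ u uniq A≢σ = begin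
  intervalSum σ A (shorterPerms (suc n))                     ≡⟨ cong (intervalSum σ A) (shorterPerms-suc n) ⟩
  intervalSum σ A (shorterPerms n ++ perms n)                ≡⟨ sumWhere-++ (μ σ) (between σ A) (shorterPerms n) (perms n) ⟩
  strict +ℤ intervalSum σ A (perms n)                       ≡⟨ cong (strict +ℤ_) top-term ⟩
  strict +ℤ (if between σ A A then μ σ A else 0ℤ)           ≡⟨ cancel ⟩
  0ℤ                                                         ∎
  where
  open ≡-Reasoning
  A = std u
  n = length u
  strict = intervalSum σ A (shorterPerms n)
  |A|≡n : length A ≡ n
  |A|≡n = length-map _ u
  top-term : intervalSum σ A (perms n) ≡ (if between σ A A then μ σ A else 0ℤ)
  top-term = sumWhere-single (μ σ) (between σ A) (perms n) (Unique-perms n) (std-∈-perms n refl uniq)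
    λ z∈ between≡ → ≼-std-length u (proj₂ (∧-true⁻ between≡)) (perms-length n z∈)
  cancel : strict +ℤ (if between σ A A then μ σ A else 0ℤ) ≡ 0ℤ
  cancel with contains σ A in σ≼A
  ... | true rewrite ≼-refl-std u | μ-unfold σ A A≢σ | σ≼A | |A|≡n = ℤ.+-inverseʳ strict
  ... | false = trans (ℤ.+-identityʳ strict) (sumWhere-zero (μ σ) (between σ A) (shorterPerms n) λ {z} _ between≡ →
          let σ≼z , z≼A = ∧-true⁻ {contains σ z} between≡ in
          contradiction (trans (sym (≼-trans {σ} {z} {A} σ≼z z≼A)) σ≼A) λ ())

-- Runs

run : ℕ → ℕ → List ℕ
run a zero    = []
run a (suc k) = a ∷ run (suc a) k

incRun≡run : ∀ a k → incRun a k ≡ run a k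
incRun≡run a k = trans (map-upTo (_+_ a) k) (applyUpTo≡run a k λ _ → refl)
  where
  applyUpTo≡run : ∀ {f} b k → (∀ i → f i ≡ b + i) → applyUpTo f k ≡ run b k
  applyUpTo≡run b zero    _    = refl
  applyUpTo≡run b (suc k) f≗b+ =
    cong₂ _∷_ (trans (f≗b+ 0) (+-identityʳ b)) (applyUpTo≡run (suc b) k λ i → trans (f≗b+ (suc i)) (+-suc b i))

run-length : ∀ a k → length (run a k) ≡ k
run-length a zero    = refl
run-length a (suc k) = cong suc (run-length (suc a) k)

∈-run⁻ : ∀ a k {x} → x ∈ run a k → a ≤ x × x < a + k
∈-run⁻ a (suc k) (here refl) = ≤-refl , m<m+n a z<s
∈-run⁻ a (suc k) {x} (there x∈) with a<x , x<1+a+k ← ∈-run⁻ (suc a) k x∈ =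
  <⇒≤ a<x , subst (x <_) (sym (+-suc a k)) x<1+a+k

∈-run⁺ : ∀ a k {x} → a ≤ x → x < a + k → x ∈ run a k
∈-run⁺ a zero    a≤x x<a+0 = contradiction (<-≤-trans x<a+0 (≤-reflexive (+-identityʳ a))) (≤⇒≯ a≤x)
∈-run⁺ a (suc k) {x} a≤x x<a+1+k with a ≟ x
... | yes refl = here refl
... | no a≢x   = there (∈-run⁺ (suc a) k (≤∧≢⇒< a≤x a≢x) (subst (x <_) (+-suc a k) x<a+1+k))

run-++ : ∀ a j r → run a j ++ run (a + j) r ≡ run a (j + r)
run-++ a zero    r = cong (λ b → run b r) (+-identityʳ a)
run-++ a (suc j) r = cong (a ∷_) (trans (cong (λ b → run (suc a) j ++ run b r) (+-suc a j)) (run-++ (suc a) j r))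

run-without : ℕ → ℕ → ℕ → List ℕ
run-without a j r = run a j ++ run (suc (a + j)) r

run-without-⊆ : ∀ a j r → run-without a j r ⊆ run a (j + suc r)
run-without-⊆ a zero    r rewrite +-identityʳ a = a ∷ʳ ⊆-refl
run-without-⊆ a (suc j) r rewrite +-suc a j = refl ∷ run-without-⊆ (suc a) j r

⊆-run-missing : ∀ a k {s} → s ⊆ run a k → s ≢ run a k →
                ∃[ j ] ∃[ r ] (k ≡ j + suc r × s ⊆ run-without a j r)
⊆-run-missing a zero    []         s≢ = contradiction refl s≢
⊆-run-missing a (suc k) {s} (_ ∷ʳ s⊆) _ = 0 , k , refl , subst (λ b → s ⊆ run (suc b) k) (sym (+-identityʳ a)) s⊆
⊆-run-missing a (suc k) {_ ∷ s} (refl ∷ s⊆) s≢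
  with j , r , k≡ , s⊆′ ← ⊆-run-missing (suc a) k s⊆ (s≢ ∘ cong (a ∷_)) =
  suc j , r , cong suc k≡ , refl ∷ subst (λ b → s ⊆ run (suc a) j ++ run (suc b) r) (sym (+-suc a j)) s⊆′

below-run : ∀ a i r → below (a + i) (run a (i + r)) ≡ i
below-run a i r = begin
  below (a + i) (run a (i + r))                              ≡⟨ cong (below (a + i)) (run-++ a i r) ⟨
  below (a + i) (run a i ++ run (a + i) r)                   ≡⟨ below-++ (a + i) (run a i) _ ⟩
  below (a + i) (run a i) + below (a + i) (run (a + i) r)    ≡⟨ cong₂ _+_ (below-all _ all<) (below-none _ none<) ⟩
  length (run a i) + 0                                       ≡⟨ trans (+-identityʳ _) (run-length a i) ⟩
  i                                                          ∎
  where
  open ≡-Reasoning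
  all< : All (_< a + i) (run a i)
  all< = All.tabulate (proj₂ ∘ ∈-run⁻ a i)
  none< : All (λ x → ¬ x < a + i) (run (a + i) r)
  none< = All.tabulate (≤⇒≯ ∘ proj₁ ∘ ∈-run⁻ (a + i) r)

map-run : ∀ (h : ℕ → ℕ) a b k → (∀ i → i < k → h (a + i) ≡ b + i) → map h (run a k) ≡ run b k
map-run h a b zero    _     = refl
map-run h a b (suc k) shift =
  cong₂ _∷_ (trans (cong h (sym (+-identityʳ a))) (trans (shift 0 z<s) (+-identityʳ b)))
    (map-run h (suc a) (suc b) k λ i i<k →
      trans (cong h (sym (+-suc a i))) (trans (shift (suc i) (s<s i<k)) (+-suc b i)))

data Direction : Set where
  ascending descending : Direction

orient : Direction → List ℕ → List ℕ
orient ascending  l = l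
orient descending l = reverse l

∈-orient⁺ : ∀ d {x l} → x ∈ l → x ∈ orient d l
∈-orient⁺ ascending  x∈ = x∈
∈-orient⁺ descending x∈ = Any.reverse⁺ x∈

∈-orient⁻ : ∀ d {x l} → x ∈ orient d l → x ∈ l
∈-orient⁻ ascending  x∈ = x∈
∈-orient⁻ descending x∈ = Any.reverse⁻ x∈

orient-⊆ : ∀ d {s l} → s ⊆ l → orient d s ⊆ orient d l
orient-⊆ ascending  s⊆l = s⊆l
orient-⊆ descending s⊆l = reverse⁺ s⊆l

orient-involutive : ∀ d l → orient d (orient d l) ≡ l
orient-involutive ascending  l = refl
orient-involutive descending l = reverse-involutive l

map-orient : ∀ d (f : ℕ → ℕ) l → map f (orient d l) ≡ orient d (map f l)
map-orient ascending  f l = refl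
map-orient descending f l = reverse-map f l

below-orient : ∀ d x l → below x (orient d l) ≡ below x l
below-orient ascending  x l = refl
below-orient descending x l = below-reverse x l

length-orient : ∀ d l → length (orient d l) ≡ length l
length-orient ascending  l = refl
length-orient descending l = length-reverse l

HasRun : ℕ → List ℕ → Set
HasRun k π = ∃[ pre ] ∃[ post ] ∃[ a ] ∃[ d ] (π ≡ pre ++ orient d (run a k) ++ post)

closeGap : ℕ → ℕ → ℕ
closeGap y x = if y <ᵇ x then pred x else x

closeGap-above : ∀ {y x} → y < x → closeGap y x ≡ pred x
closeGap-above {y} {x} y<x rewrite Equivalence.to T-≡ (<⇒<ᵇ y<x) = refl

closeGap-below : ∀ {y x} → ¬ y < x → closeGap y x ≡ x
closeGap-below {y} {x} y≮x with y <ᵇ x in y<ᵇx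
... | true  = contradiction (<ᵇ⇒< y x (Equivalence.from T-≡ y<ᵇx)) y≮x
... | false = refl

closeGap-increasing : ∀ {y l} → y ∉ l → StrictlyIncreasingOn (closeGap y) l
closeGap-increasing {y} y∉l {x} {x′} x∈ _ x<x′ with y <? x | y <? x′
... | yes y<x | yes y<x′ rewrite closeGap-above y<x | closeGap-above y<x′ = pred-mono-< ⦃ ≢-nonZero (m<n⇒n≢0 y<x) ⦄ x<x′
... | yes y<x | no y≮x′  = contradiction (<-trans y<x x<x′) y≮x′
... | no y≮x  | yes y<x′ rewrite closeGap-below y≮x | closeGap-above y<x′ =
  <-≤-trans (≤∧≢⇒< (≮⇒≥ y≮x) λ { refl → y∉l x∈ }) (pred-mono-≤ y<x′)
... | no y≮x  | no y≮x′  rewrite closeGap-below y≮x | closeGap-below y≮x′ = x<x′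

closeGap-run-without : ∀ a j r → map (closeGap (a + j)) (run-without a j r) ≡ run a (j + r)
closeGap-run-without a j r = begin
  map (closeGap y) (run a j ++ run (suc y) r)              ≡⟨ map-++ (closeGap y) (run a j) _ ⟩
  map (closeGap y) (run a j) ++ map (closeGap y) (run (suc y) r)
    ≡⟨ cong₂ _++_ (map-run (closeGap y) a a j λ i i<j → closeGap-below (<⇒≯ (+-monoʳ-< a i<j)))
                  (map-run (closeGap y) (suc y) y r λ i _ → closeGap-above (s≤s (m≤m+n y i))) ⟩
  run a j ++ run y r                                       ≡⟨ run-++ a j r ⟩
  run a (j + r)                                            ∎
  where
  open ≡-Reasoning
  y = a + j

Unique-++⁻-disjoint : ∀ xs {ys : List ℕ} → Unique (xs ++ ys) → Disjoint xs ys
Unique-++⁻-disjoint (x ∷ xs) (x∉ ∷ _) (here refl , x∈ys) = All.lookup x∉ (∈-++⁺ʳ xs x∈ys) refl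
Unique-++⁻-disjoint (x ∷ xs) (_ ∷ u)  (there v∈ , v∈ys)  = Unique-++⁻-disjoint xs u (v∈ , v∈ys)

module WithRun (pre post : List ℕ) (a k′ : ℕ) (d : Direction)
             (uniq : Unique (pre ++ orient d (run a (suc k′)) ++ post)) where

  k : ℕ
  k = suc k′

  R : List ℕ
  R = orient d (run a k)

  π : List ℕ
  π = pre ++ R ++ post

  without : ℕ → ℕ → List ℕ
  without j r = pre ++ orient d (run-without a j r) ++ post

  without-⊆ : ∀ j r → k ≡ j + suc r → without j r ⊆ π
  without-⊆ j r k≡ = ++⁺ (⊆-refl {x = pre}) (++⁺ (orient-⊆ d gap⊆) (⊆-refl {x = post}))
    where
    gap⊆ : run-without a j r ⊆ run a k
    gap⊆ = subst (λ m → run-without a j r ⊆ run a m) (sym k≡) (run-without-⊆ a j r)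

  Outside : ℕ → Set
  Outside x = x < a ⊎ a + k ≤ x

  outside : ∀ {x} → x ∉ R → Outside x
  outside {x} x∉R with x <? a | x <? a + k
  ... | yes x<a | _        = inj₁ x<a
  ... | no x≮a  | no x≮a+k = inj₂ (≮⇒≥ x≮a+k)
  ... | no x≮a  | yes x<a+k = contradiction (∈-orient⁺ d (∈-run⁺ a k (≮⇒≥ x≮a) x<a+k)) x∉R

  pre-outside : ∀ {x} → x ∈ pre → Outside x
  pre-outside x∈ = outside λ x∈R → Unique-++⁻-disjoint pre uniq (x∈ , ∈-++⁺ˡ x∈R)

  post-outside : ∀ {x} → x ∈ post → Outside x
  post-outside x∈ = outside λ x∈R → Unique-++⁻-disjoint R (Unique-resp-⊇ (++⁺ˡ pre ⊆-refl) uniq) (x∈R , x∈)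

  inside : ∀ {j} → j < k → ¬ Outside (a + j)
  inside j<k (inj₁ a+j<a)  = <⇒≱ a+j<a (m≤m+n a _)
  inside j<k (inj₂ a+k≤a+j) = <⇒≱ (+-monoʳ-< a j<k) a+k≤a+j

  closeGap-outside : ∀ {j x} → j < k → Outside x → closeGap (a + j) x ≡ closeGap a x
  closeGap-outside {j} j<k (inj₁ x<a) =
    trans (closeGap-below (<⇒≯ (<-≤-trans x<a (m≤m+n a j)))) (sym (closeGap-below (<⇒≯ x<a)))
  closeGap-outside {j} j<k (inj₂ a+k≤x) =
    trans (closeGap-above (<-≤-trans (+-monoʳ-< a j<k) a+k≤x)) (sym (closeGap-above (<-≤-trans (m<m+n a z<s) a+k≤x)))

  closed : ℕ → List ℕ
  closed m = map (closeGap a) pre ++ orient d (run a m) ++ map (closeGap a) post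

  -- Closing the gap left by a + j takes every one-entry deletion of the run to the same list.
  std-without≡closed : ∀ j r → k ≡ j + suc r → std (without j r) ≡ std (closed (j + r))
  std-without≡closed j r k≡ = begin
    std (without j r)                    ≡⟨ std-map (closeGap-increasing y∉) ⟨
    std (map (closeGap y) (without j r)) ≡⟨ cong std closes ⟩
    std (closed (j + r))                 ∎
    where
    open ≡-Reasoning
    y = a + j
    j<k : j < k
    j<k = subst (j <_) (sym k≡) (m<m+n j z<s)
    y∉ : y ∉ without j r
    y∉ y∈ with ∈-++⁻ pre y∈
    ... | inj₁ y∈pre  = inside j<k (pre-outside y∈pre)
    ... | inj₂ y∈rest with ∈-++⁻ (orient d (run-without a j r)) y∈rest
    ... | inj₂ y∈post = inside j<k (post-outside y∈post)
    ... | inj₁ y∈gap  with ∈-++⁻ (run a j) (∈-orient⁻ d y∈gap)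
    ... | inj₁ y∈left  = <-irrefl refl (proj₂ (∈-run⁻ a j y∈left))
    ... | inj₂ y∈right = <-irrefl refl (proj₁ (∈-run⁻ (suc y) r y∈right))
    context : ∀ {l} → (∀ {x} → x ∈ l → Outside x) → map (closeGap y) l ≡ map (closeGap a) l
    context out = map-cong-local (All.tabulate (closeGap-outside j<k ∘ out))
    closes : map (closeGap y) (without j r) ≡ closed (j + r)
    closes = begin
      map (closeGap y) (pre ++ orient d (run-without a j r) ++ post)
        ≡⟨ map-++ (closeGap y) pre _ ⟩
      map (closeGap y) pre ++ map (closeGap y) (orient d (run-without a j r) ++ post)
        ≡⟨ cong (map (closeGap y) pre ++_) (map-++ (closeGap y) (orient d (run-without a j r)) post) ⟩
      map (closeGap y) pre ++ map (closeGap y) (orient d (run-without a j r)) ++ map (closeGap y) post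
        ≡⟨ cong₂ _++_ (context pre-outside) (cong₂ _++_ (map-orient d (closeGap y) _) (context post-outside)) ⟩
      map (closeGap a) pre ++ orient d (map (closeGap y) (run-without a j r)) ++ map (closeGap a) post
        ≡⟨ cong (λ l → map (closeGap a) pre ++ orient d l ++ map (closeGap a) post) (closeGap-run-without a j r) ⟩
      closed (j + r) ∎

  shortened : List ℕ
  shortened = without k′ 0

  k≡k′+1 : k ≡ k′ + suc 0
  k≡k′+1 = sym (+-comm k′ 1)

  std-without≡std-shortened : ∀ j r → k ≡ j + suc r → std (without j r) ≡ std shortened
  std-without≡std-shortened j r k≡ = begin
    std (without j r)     ≡⟨ std-without≡closed j r k≡ ⟩
    std (closed (j + r))  ≡⟨ cong (std ∘ closed) j+r≡ ⟩
    std (closed (k′ + 0)) ≡⟨ std-without≡closed k′ 0 k≡k′+1 ⟨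
    std shortened           ∎
    where
    open ≡-Reasoning
    j+r≡ : j + r ≡ k′ + 0
    j+r≡ = trans (suc-injective (trans (sym (+-suc j r)) (sym k≡))) (sym (+-identityʳ k′))

  std-keeps-run : ∀ {s₁ s₃} → s₁ ⊆ pre → s₃ ⊆ post → HasRun k (std (s₁ ++ R ++ s₃))
  std-keeps-run {s₁} {s₃} s₁⊆ s₃⊆ = map (rank s) s₁ , map (rank s) s₃ , rank s a , d , std≡
    where
    s = s₁ ++ R ++ s₃
    same-side : ∀ {i x} → i < k → Outside x → x < a + i ⇔ x < a
    same-side {i} i<k (inj₁ x<a)    = mk⇔ (λ _ → x<a) (λ _ → <-≤-trans x<a (m≤m+n a i))
    same-side {i} i<k (inj₂ a+k≤x) =
      mk⇔ (λ x<a+i → contradiction (<-≤-trans x<a+i (<⇒≤ (+-monoʳ-< a i<k))) (≤⇒≯ a+k≤x))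
          (λ x<a → contradiction (<-≤-trans x<a (m≤m+n a k)) (≤⇒≯ a+k≤x))
    below-context : ∀ {i l} → i < k → (∀ {x} → x ∈ l → Outside x) → below (a + i) l ≡ below a l
    below-context {i} {l} i<k out = trans (cong (below (a + i)) (sym (map-id l))) (below-map id l (same-side i<k ∘ out))
    below-s : ∀ i → i < k → below (a + i) s ≡ below a s₁ + (i + below a s₃)
    below-s i i<k = begin
      below (a + i) (s₁ ++ R ++ s₃)                               ≡⟨ below-++ (a + i) s₁ (R ++ s₃) ⟩
      below (a + i) s₁ + below (a + i) (R ++ s₃)                  ≡⟨ cong (_+_ (below (a + i) s₁)) (below-++ (a + i) R s₃) ⟩
      below (a + i) s₁ + (below (a + i) R + below (a + i) s₃)
        ≡⟨ cong₂ _+_ (below-context i<k (pre-outside ∘ Any-resp-⊆ s₁⊆))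
                     (cong₂ _+_ below-R (below-context i<k (post-outside ∘ Any-resp-⊆ s₃⊆))) ⟩
      below a s₁ + (i + below a s₃)                               ∎
      where
      open ≡-Reasoning
      below-R : below (a + i) R ≡ i
      below-R = trans (below-orient d (a + i) (run a k))
                      (subst (λ m → below (a + i) (run a m) ≡ i) (m+[n∸m]≡n (<⇒≤ i<k)) (below-run a i (k ∸ i)))
    rank-run : ∀ i → i < k → rank s (a + i) ≡ rank s a + i
    rank-run i i<k = cong suc (begin
      below (a + i) s                  ≡⟨ below-s i i<k ⟩
      below a s₁ + (i + below a s₃)    ≡⟨ cong (_+_ (below a s₁)) (+-comm i _) ⟩
      below a s₁ + (below a s₃ + i)    ≡⟨ +-assoc (below a s₁) _ i ⟨
      below a s₁ + (0 + below a s₃) + i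
        ≡⟨ cong (_+ i) (trans (cong (λ b → below b s) (sym (+-identityʳ a))) (below-s 0 z<s)) ⟨
      below a s + i                    ∎)
      where open ≡-Reasoning
    std≡ : std s ≡ map (rank s) s₁ ++ orient d (run (rank s a) k) ++ map (rank s) s₃
    std≡ = trans (map-++ (rank s) s₁ (R ++ s₃)) (cong (map (rank s) s₁ ++_)
             (trans (map-++ (rank s) R s₃) (cong (_++ map (rank s) s₃)
               (trans (map-orient d (rank s) (run a k)) (cong (orient d) (map-run (rank s) a (rank s a) k rank-run))))))

  pattern-dichotomy : ∀ {s} → s ⊆ π → std s ≼ std shortened ⊎ HasRun k (std s)
  pattern-dichotomy s⊆π
    with s₁ , t , refl , s₁⊆ , t⊆ ← ⊆-++⁻ pre s⊆π
    with s₂ , s₃ , refl , s₂⊆ , s₃⊆ ← ⊆-++⁻ R t⊆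
    with orient d s₂ ≡? run a k
  ... | yes s₂-whole = inj₂ (subst (λ w → HasRun k (std (s₁ ++ w ++ s₃))) R≡s₂ (std-keeps-run s₁⊆ s₃⊆))
    where
    R≡s₂ : R ≡ s₂
    R≡s₂ = trans (cong (orient d) (sym s₂-whole)) (orient-involutive d s₂)
  ... | no s₂-partial
    with j , r , k≡ , s₂⊆gap ← ⊆-run-missing a k (subst (orient d s₂ ⊆_) (orient-involutive d (run a k)) (orient-⊆ d s₂⊆))
                                               s₂-partial
    = inj₁ (subst (std (s₁ ++ s₂ ++ s₃) ≼_) (std-without≡std-shortened j r k≡)
                  (⊆⇒std≼std (++⁺ s₁⊆ (++⁺ s₂⊆′ s₃⊆))))
    where
    s₂⊆′ : s₂ ⊆ orient d (run-without a j r)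
    s₂⊆′ = subst (_⊆ _) (orient-involutive d s₂) (orient-⊆ d s₂⊆gap)

  length-around : ∀ l → length (pre ++ orient d l ++ post) ≡ length pre + (length l + length post)
  length-around l = trans (length-++ pre)
    (cong (_+_ (length pre)) (trans (length-++ (orient d l)) (cong (_+ length post) (length-orient d l))))

  length-π : length π ≡ suc (length shortened)
  length-π = begin
    length π                                                    ≡⟨ length-around (run a k) ⟩
    length pre + (length (run a k) + length post)               ≡⟨ cong (λ m → length pre + (m + length post)) (run-length a k) ⟩
    length pre + (suc k′ + length post)                         ≡⟨ +-suc (length pre) _ ⟩
    suc (length pre + (k′ + length post))                       ≡⟨ cong (λ m → suc (length pre + (m + length post))) gap-length ⟨
    suc (length pre + (length (run-without a k′ 0) + length post)) ≡⟨ cong suc (length-around (run-without a k′ 0)) ⟨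
    suc (length shortened)                                        ∎
    where
    open ≡-Reasoning
    gap-length : length (run-without a k′ 0) ≡ k′
    gap-length = trans (length-++ (run a k′)) (trans (cong (_+ 0) (run-length a k′)) (+-identityʳ k′))

  Unique-shortened : Unique shortened
  Unique-shortened = Unique-resp-⊇ (without-⊆ k′ 0 k≡k′+1) uniq

  k≤|π| : k ≤ length π
  k≤|π| = begin
    k                                           ≡⟨ run-length a k ⟨
    length (run a k)                            ≤⟨ m≤m+n _ (length post) ⟩
    length (run a k) + length post              ≤⟨ m≤n+m _ (length pre) ⟩
    length pre + (length (run a k) + length post) ≡⟨ length-around (run a k) ⟨
    length π                                    ∎
    where open ≤-Reasoning

between-∧-contains : ∀ σ {τ π} → τ ≼ π → ∀ z → between σ π z ∧ contains z τ ≡ between σ τ z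
between-∧-contains σ {τ} {π} τ≼π z with contains z τ in z≼τ | contains σ z
... | false | b = trans (∧-zeroʳ (b ∧ contains z π)) (sym (∧-zeroʳ b))
... | true  | b rewrite ≼-trans {z} {τ} {π} z≼τ τ≼π = ∧-identityʳ (b ∧ true)

μ-vanishes-on-runs : ∀ n σ k π → length π < n → 2 + length σ ≤ k → Unique π → HasRun k π → μ σ π ≡ 0ℤ
μ-vanishes-on-runs (suc n) σ (suc k′) _ |π|<n 2+|σ|≤k uniq (pre , post , a , d , refl) = goal
  where
  open WithRun pre post a k′ d uniq
  A = std shortened
  |σ|<|shortened| : length σ < length shortened
  |σ|<|shortened| = ≤-trans (s≤s⁻¹ 2+|σ|≤k) (s≤s⁻¹ (subst (k ≤_) length-π k≤|π|))
  A≢σ : A ≢ σ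
  A≢σ refl = <-irrefl (length-map _ shortened) |σ|<|shortened|
  π≢σ : π ≢ σ
  π≢σ refl = <-irrefl length-π (m<n⇒m<1+n |σ|<|shortened|)
  A≼π : A ≼ π
  A≼π = ⊆⇒≼ {shortened} (without-⊆ k′ 0 k≡k′+1)
  L = shorterPerms (length π)
  off-A-vanishes : ∀ {z} → z ∈ L → between σ π z ∧ not (contains z A) ≡ true → μ σ z ≡ 0ℤ
  off-A-vanishes {z} z∈ between≡
    with between-z , z⋠A ← ∧-true⁻ {between σ π z} between≡
    with s , s⊆π , refl ← ≼⇒⊆ {z} {π} (proj₂ (∧-true⁻ {contains σ z} between-z))
    with pattern-dichotomy s⊆π
  ... | inj₁ s≼A = contradiction (subst (λ b → not b ≡ true) s≼A z⋠A) λ ()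
  ... | inj₂ has-run = μ-vanishes-on-runs n σ (suc k′) (std s)
        (<-≤-trans (∈-shorterPerms⁻ (length π) z∈) (s≤s⁻¹ |π|<n)) 2+|σ|≤k
        (Unique-std (Unique-resp-⊇ s⊆π uniq)) has-run
  interval-vanishes : intervalSum σ π L ≡ 0ℤ
  interval-vanishes = begin
    intervalSum σ π L  ≡⟨ sumWhere-split (μ σ) (between σ π) (λ z → contains z A) L ⟩
    sumWhere (μ σ) (λ z → between σ π z ∧ contains z A) L
      +ℤ sumWhere (μ σ) (λ z → between σ π z ∧ not (contains z A)) L
      ≡⟨ cong₂ _+ℤ_ (sumWhere-cong (μ σ) L (between-∧-contains σ {A} {π} A≼π))
                    (sumWhere-zero (μ σ) _ L off-A-vanishes) ⟩
    intervalSum σ A L +ℤ 0ℤ  ≡⟨ ℤ.+-identityʳ _ ⟩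
    intervalSum σ A L        ≡⟨ cong (intervalSum σ A ∘ shorterPerms) length-π ⟩
    intervalSum σ A (shorterPerms (suc (length shortened)))  ≡⟨ intervalSum-closed σ shortened Unique-shortened A≢σ ⟩
    0ℤ ∎
    where open ≡-Reasoning
  goal : μ σ π ≡ 0ℤ
  goal rewrite μ-unfold σ π π≢σ with contains σ π
  ... | false = refl
  ... | true  = cong -_ interval-vanishes

Unique-[1‥] : ∀ n → Unique [1‥ n ]
Unique-[1‥] n = Unique.map⁺ suc-injective (Unique.upTo⁺ n)

IsPerm⇒Unique : ∀ {π} → IsPerm π → Unique π
IsPerm⇒Unique {π} π↭ = Unique-resp-↭ (↭⇒↭ₛ (↭-sym π↭)) (Unique-[1‥] (length π))

corollary2 : (k : ℕ) → 3 ≤ k → (π : List ℕ) → IsPerm π →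
    (∃[ pre ] ∃[ post ] ∃[ a ]
       ((π ≡ pre ++ incRun a k ++ post) ⊎ (π ≡ pre ++ reverse (incRun a k) ++ post))) →
    μ [1‥ k ∸ 2 ] π ≡ + 0
corollary2 k 3≤k π π↭ (pre , post , a , π≡) =
  μ-vanishes-on-runs (suc (length π)) [1‥ k ∸ 2 ] k π ≤-refl 2+|σ|≤k (IsPerm⇒Unique π↭) has-run
  where
  2+|σ|≤k : 2 + length [1‥ k ∸ 2 ] ≤ k
  2+|σ|≤k = ≤-reflexive (begin
    2 + length [1‥ k ∸ 2 ]  ≡⟨ cong (_+_ 2) (trans (length-map suc (upTo (k ∸ 2))) (length-upTo (k ∸ 2))) ⟩
    2 + (k ∸ 2)             ≡⟨ m+[n∸m]≡n (≤-trans (n≤1+n 2) 3≤k) ⟩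
    k                       ∎)
    where open ≡-Reasoning
  has-run : HasRun k π
  has-run = pre , post , a ,
    [ (λ π≡inc → ascending  , trans π≡inc (cong (λ w → pre ++ w ++ post) (incRun≡run a k)))
    , (λ π≡dec → descending , trans π≡dec (cong (λ w → pre ++ reverse w ++ post) (incRun≡run a k))) ]′ π≡
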